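{- For all even integers $k\geq 4$, every 2-coloring of \[ \{1,2,3,k+1,k+2,2k,2(k+1),2(k+2),k(k+1),k(k+2),2k(k+1),2k(k+2)\} \] has a monochromatic solution to $x_1+\cdots+x_k=y$.
   Context: A 2-coloring of a set $A\subseteq\mathbb{N}$ is a function $\Delta:A\to\{0,1\}$. A monochromatic solution to $x_1+\cdots+x_k=y$ is a tuple $(a_1,\ldots,a_k,b)$ of elements of $A$, with $a_1,\ldots,a_k$ not necessarily distinct, such that $a_1+\cdots+a_k=b$ and $\Delta(a_1)=\cdots=\Delta(a_k)=\Delta(b)$. -}

module Defs where

open import Data.Nat using (ℕ; _+_; _*_)
open import Data.Bool using (Bool)
open import Data.Fin using (Fin)
open import Data.List using (List; []; _∷_)
open import Data.List.Membership.Propositional using (_∈_)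
open import Data.Product using (Σ; _×_)
open import Relation.Binary.PropositionalEquality using (_≡_)

sumFin : (k : ℕ) → (Fin k → ℕ) → ℕ
sumFin Data.Nat.zero f = 0
sumFin (Data.Nat.suc k) f = f Fin.zero + sumFin k (λ i → f (Fin.suc i))

setA : ℕ → List ℕ
setA k = 1 ∷ 2 ∷ 3 ∷ (k + 1) ∷ (k + 2) ∷ (2 * k) ∷ (2 * (k + 1)) ∷ (2 * (k + 2))
       ∷ (k * (k + 1)) ∷ (k * (k + 2)) ∷ (2 * k * (k + 1)) ∷ (2 * k * (k + 2)) ∷ []

-- A 2-coloring of a set A ⊆ ℕ (given as a list) is represented by a function
-- ℕ → Bool; only its values on A are ever used (every coloring of A extends).
MonoSolution : (k : ℕ) → List ℕ → (ℕ → Bool) → Set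
MonoSolution k A Δ =
  Σ (Fin k → ℕ) λ a → Σ ℕ λ b →
    ((i : Fin k) → a i ∈ A) × (b ∈ A) × (sumFin k a ≡ b) ×
    ((i : Fin k) → Δ (a i) ≡ Δ b)

-- Let c be the colour of 2.  Each identity k·x = y between elements of the set (2k = k·2,
-- k(k+r) = k·(k+r), 2k(k+r) = k·2(k+r)) forces y to get the colour opposite to x.
-- If 3 has colour c, then 2(k+2) = (k−4)·2 + 4·3 and 2(k+1) = (k−2)·2 + 2·3 get colour ¬c,
-- so 2k(k+1) and 2k(k+2) get colour c, and (k−3)·2 + 2·3 + 2k(k+1) = 2k(k+2) is monochromatic.
-- Otherwise 3 and 2k have colour ¬c, and since k = 2m is even, m·1 + m·3 = 2k forces 1 to
-- have colour c; then k+1 = (k−1)·1 + 2 and k+2 = (k−2)·1 + 2·2 get colour ¬c, so k(k+1) and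
-- k(k+2) get colour c, and (k−2)·1 + 2 + k(k+1) = k(k+2) is monochromatic.
module Submission where

open import Defs
open import Data.Nat using (ℕ; _≤_; _*_; _+_; zero; suc)
open import Data.Nat.Properties using (+-comm; +-identityʳ; *-comm; ≤-trans; m≤m+n; m≤n⇒∃[o]m+o≡n)
open import Data.Nat.Tactic.RingSolver using (solve-∀)
open import Data.Bool using (Bool; true; false; not)
open import Data.Fin using (#_)
open import Data.List using (List; []; _∷_; length; lookup; replicate; concatMap; map)
open import Data.List.Properties using (length-++; length-replicate)
open import Data.Nat.ListAction using (sum)
open import Data.Nat.ListAction.Properties using (sum-++)
open import Data.List.Relation.Unary.All as All using (All; []; _∷_)
open import Data.List.Relation.Unary.All.Properties using (++⁺; replicate⁺)
open import Data.List.Membership.Propositional using (_∈_)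
open import Data.List.Membership.Propositional.Properties using (∈-lookup)
open import Data.Product using (_×_; _,_; proj₁; proj₂; uncurry)
open import Data.Sum using (_⊎_; inj₁; inj₂)
open import Relation.Binary.PropositionalEquality using (_≡_; refl; sym; trans; cong; cong₂; subst)

sumFin-lookup : (xs : List ℕ) → sumFin (length xs) (lookup xs) ≡ sum xs
sumFin-lookup []       = refl
sumFin-lookup (x ∷ xs) = cong (x +_) (sumFin-lookup xs)

sum-replicate : ∀ n x → sum (replicate n x) ≡ n * x
sum-replicate zero    x = refl
sum-replicate (suc n) x = cong (x +_) (sum-replicate n x)

-- A multiset of summands, as pairs (multiplicity , value).
Summands : Set
Summands = List (ℕ × ℕ)

size : Summands → ℕ
size S = sum (map proj₁ S)

weight : Summands → ℕ
weight S = sum (map (uncurry _*_) S)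

values : Summands → List ℕ
values = map proj₂

expand : Summands → List ℕ
expand = concatMap (uncurry replicate)

length-expand : ∀ S → length (expand S) ≡ size S
length-expand []            = refl
length-expand ((c , v) ∷ S) =
  trans (length-++ (replicate c v)) (cong₂ _+_ (length-replicate c) (length-expand S))

sum-expand : ∀ S → sum (expand S) ≡ weight S
sum-expand []            = refl
sum-expand ((c , v) ∷ S) =
  trans (sum-++ (replicate c v) (expand S)) (cong₂ _+_ (sum-replicate c v) (sum-expand S))

expand⁺ : ∀ {P : ℕ → Set} S → All P (values S) → All P (expand S)
expand⁺ []            []       = []
expand⁺ ((c , v) ∷ S) (p ∷ ps) = ++⁺ (replicate⁺ c p) (expand⁺ S ps)

module _ {A : List ℕ} {Δ : ℕ → Bool} {c : Bool} where

  list-solution : ∀ {b} (xs : List ℕ) → All (_∈ A) xs → All (λ x → Δ x ≡ c) xs →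
                  b ∈ A → Δ b ≡ c → sum xs ≡ b → MonoSolution (length xs) A Δ
  list-solution xs xs⊆A xs-c b∈A b-c Σxs≡b =
    lookup xs , _ ,
    (λ i → All.lookup xs⊆A (∈-lookup i)) , b∈A ,
    trans (sumFin-lookup xs) Σxs≡b ,
    (λ i → trans (All.lookup xs-c (∈-lookup i)) (sym b-c))

  summands-solution : ∀ {k b} (S : Summands) → size S ≡ k →
                      All (_∈ A) (values S) → All (λ v → Δ v ≡ c) (values S) →
                      b ∈ A → Δ b ≡ c → weight S ≡ b → MonoSolution k A Δ
  summands-solution S refl S⊆A S-c b∈A b-c ΣS≡b =
    subst (λ k → MonoSolution k A Δ) (length-expand S)
      (list-solution (expand S) (expand⁺ S S⊆A) (expand⁺ S S-c) b∈A b-c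
        (trans (sum-expand S) ΣS≡b))

  replicate-solution : ∀ {k v b} → v ∈ A → Δ v ≡ c → b ∈ A → Δ b ≡ c → k * v ≡ b →
                       MonoSolution k A Δ
  replicate-solution {k} {v} v∈A v-c b∈A b-c kv≡b =
    summands-solution ((k , v) ∷ []) (+-identityʳ k) (v∈A ∷ []) (v-c ∷ []) b∈A b-c
      (trans (+-identityʳ (k * v)) kv≡b)

m*[2*n]≡2*m*n : ∀ m n → m * (2 * n) ≡ 2 * m * n
m*[2*n]≡2*m*n = solve-∀

same-or-opposite : ∀ x y → x ≡ y ⊎ x ≡ not y
same-or-opposite false false = inj₁ refl
same-or-opposite false true  = inj₂ refl
same-or-opposite true  false = inj₂ refl
same-or-opposite true  true  = inj₁ refl

module _ (Δ : ℕ → Bool) where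

  Solution : ℕ → Set
  Solution k = MonoSolution k (setA k) Δ

  -- Membership in setA k is proved by position: ∈-lookup (# i) is the i-th listed element.

  ones+twos≡k+1 : ∀ {k} c → 1 ≤ k → Δ 1 ≡ c → Δ 2 ≡ c → Δ (k + 1) ≡ c → Solution k
  ones+twos≡k+1 c 1≤k e₁ e₂ e with m≤n⇒∃[o]m+o≡n 1≤k
  ... | j , refl =
    summands-solution ((j , 1) ∷ (1 , 2) ∷ []) (+-comm j 1)
      (∈-lookup (# 0) ∷ ∈-lookup (# 1) ∷ []) (e₁ ∷ e₂ ∷ []) (∈-lookup (# 3)) e
      (identity j)
    where
    identity : ∀ j → j * 1 + (1 * 2 + 0) ≡ 1 + j + 1
    identity = solve-∀

  ones+twos≡k+2 : ∀ {k} c → 2 ≤ k → Δ 1 ≡ c → Δ 2 ≡ c → Δ (k + 2) ≡ c → Solution k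
  ones+twos≡k+2 c 2≤k e₁ e₂ e with m≤n⇒∃[o]m+o≡n 2≤k
  ... | j , refl =
    summands-solution ((j , 1) ∷ (2 , 2) ∷ []) (+-comm j 2)
      (∈-lookup (# 0) ∷ ∈-lookup (# 1) ∷ []) (e₁ ∷ e₂ ∷ []) (∈-lookup (# 4)) e
      (identity j)
    where
    identity : ∀ j → j * 1 + (2 * 2 + 0) ≡ 2 + j + 2
    identity = solve-∀

  ones+threes≡2k : ∀ {k} m c → k ≡ 2 * m → Δ 1 ≡ c → Δ 3 ≡ c → Δ (2 * k) ≡ c → Solution k
  ones+threes≡2k m c refl e₁ e₃ e =
    summands-solution ((m , 1) ∷ (m , 3) ∷ []) refl
      (∈-lookup (# 0) ∷ ∈-lookup (# 2) ∷ []) (e₁ ∷ e₃ ∷ []) (∈-lookup (# 5)) e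
      (identity m)
    where
    identity : ∀ m → m * 1 + (m * 3 + 0) ≡ 2 * (2 * m)
    identity = solve-∀

  twos+threes≡2[k+1] : ∀ {k} c → 2 ≤ k → Δ 2 ≡ c → Δ 3 ≡ c → Δ (2 * (k + 1)) ≡ c → Solution k
  twos+threes≡2[k+1] c 2≤k e₂ e₃ e with m≤n⇒∃[o]m+o≡n 2≤k
  ... | j , refl =
    summands-solution ((j , 2) ∷ (2 , 3) ∷ []) (+-comm j 2)
      (∈-lookup (# 1) ∷ ∈-lookup (# 2) ∷ []) (e₂ ∷ e₃ ∷ []) (∈-lookup (# 6)) e
      (identity j)
    where
    identity : ∀ j → j * 2 + (2 * 3 + 0) ≡ 2 * (2 + j + 1)
    identity = solve-∀

  twos+threes≡2[k+2] : ∀ {k} c → 4 ≤ k → Δ 2 ≡ c → Δ 3 ≡ c → Δ (2 * (k + 2)) ≡ c → Solution k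
  twos+threes≡2[k+2] c 4≤k e₂ e₃ e with m≤n⇒∃[o]m+o≡n 4≤k
  ... | j , refl =
    summands-solution ((j , 2) ∷ (4 , 3) ∷ []) (+-comm j 4)
      (∈-lookup (# 1) ∷ ∈-lookup (# 2) ∷ []) (e₂ ∷ e₃ ∷ []) (∈-lookup (# 7)) e
      (identity j)
    where
    identity : ∀ j → j * 2 + (4 * 3 + 0) ≡ 2 * (4 + j + 2)
    identity = solve-∀

  ones+twos+k[k+1]≡k[k+2] : ∀ {k} c → 2 ≤ k → Δ 1 ≡ c → Δ 2 ≡ c → Δ (k * (k + 1)) ≡ c →
                             Δ (k * (k + 2)) ≡ c → Solution k
  ones+twos+k[k+1]≡k[k+2] c 2≤k e₁ e₂ e₃ e with m≤n⇒∃[o]m+o≡n 2≤k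
  ... | j , refl =
    summands-solution ((j , 1) ∷ (1 , 2) ∷ (1 , (2 + j) * (2 + j + 1)) ∷ []) (+-comm j 2)
      (∈-lookup (# 0) ∷ ∈-lookup (# 1) ∷ ∈-lookup (# 8) ∷ []) (e₁ ∷ e₂ ∷ e₃ ∷ [])
      (∈-lookup (# 9)) e
      (identity j)
    where
    identity : ∀ j → j * 1 + (1 * 2 + (1 * ((2 + j) * (2 + j + 1)) + 0)) ≡ (2 + j) * (2 + j + 2)
    identity = solve-∀

  twos+threes+2k[k+1]≡2k[k+2] : ∀ {k} c → 3 ≤ k → Δ 2 ≡ c → Δ 3 ≡ c → Δ (2 * k * (k + 1)) ≡ c →
                                 Δ (2 * k * (k + 2)) ≡ c → Solution k
  twos+threes+2k[k+1]≡2k[k+2] c 3≤k e₂ e₃ e₄ e with m≤n⇒∃[o]m+o≡n 3≤k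
  ... | j , refl =
    summands-solution ((j , 2) ∷ (2 , 3) ∷ (1 , 2 * (3 + j) * (3 + j + 1)) ∷ []) (+-comm j 3)
      (∈-lookup (# 1) ∷ ∈-lookup (# 2) ∷ ∈-lookup (# 10) ∷ []) (e₂ ∷ e₃ ∷ e₄ ∷ [])
      (∈-lookup (# 11)) e
      (identity j)
    where
    identity : ∀ j → j * 2 + (2 * 3 + (1 * (2 * (3 + j) * (3 + j + 1)) + 0)) ≡
                     2 * (3 + j) * (3 + j + 2)
    identity = solve-∀

  module _ {k} (4≤k : 4 ≤ k) where

    three-like-two : ∀ c → Δ 2 ≡ c → Δ 3 ≡ c → Solution k
    three-like-two c Δ2≡c Δ3≡c with same-or-opposite (Δ (2 * (k + 2))) c
    ... | inj₁ Δ[2[k+2]]≡c = twos+threes≡2[k+2] c 4≤k Δ2≡c Δ3≡c Δ[2[k+2]]≡c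
    ... | inj₂ Δ[2[k+2]]≡¬c with same-or-opposite (Δ (2 * k * (k + 2))) c
    ...   | inj₂ Δ[2k[k+2]]≡¬c =
            replicate-solution (∈-lookup (# 7)) Δ[2[k+2]]≡¬c (∈-lookup (# 11)) Δ[2k[k+2]]≡¬c
              (m*[2*n]≡2*m*n k (k + 2))
    ...   | inj₁ Δ[2k[k+2]]≡c with same-or-opposite (Δ (2 * (k + 1))) c
    ...     | inj₁ Δ[2[k+1]]≡c = twos+threes≡2[k+1] c (≤-trans (m≤m+n 2 2) 4≤k) Δ2≡c Δ3≡c Δ[2[k+1]]≡c
    ...     | inj₂ Δ[2[k+1]]≡¬c with same-or-opposite (Δ (2 * k * (k + 1))) c
    ...       | inj₂ Δ[2k[k+1]]≡¬c =
                replicate-solution (∈-lookup (# 6)) Δ[2[k+1]]≡¬c (∈-lookup (# 10)) Δ[2k[k+1]]≡¬c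
                  (m*[2*n]≡2*m*n k (k + 1))
    ...       | inj₁ Δ[2k[k+1]]≡c =
                twos+threes+2k[k+1]≡2k[k+2] c (≤-trans (m≤m+n 3 1) 4≤k) Δ2≡c Δ3≡c
                  Δ[2k[k+1]]≡c Δ[2k[k+2]]≡c

    three-unlike-two : ∀ m c → k ≡ 2 * m → Δ 2 ≡ c → Δ 3 ≡ not c → Δ (2 * k) ≡ not c → Solution k
    three-unlike-two m c k≡2m Δ2≡c Δ3≡¬c Δ2k≡¬c with same-or-opposite (Δ 1) c
    ... | inj₂ Δ1≡¬c = ones+threes≡2k m (not c) k≡2m Δ1≡¬c Δ3≡¬c Δ2k≡¬c
    ... | inj₁ Δ1≡c with same-or-opposite (Δ (k + 1)) c
    ...   | inj₁ Δ[k+1]≡c = ones+twos≡k+1 c (≤-trans (m≤m+n 1 3) 4≤k) Δ1≡c Δ2≡c Δ[k+1]≡c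
    ...   | inj₂ Δ[k+1]≡¬c with same-or-opposite (Δ (k * (k + 1))) c
    ...     | inj₂ Δ[k[k+1]]≡¬c =
              replicate-solution (∈-lookup (# 3)) Δ[k+1]≡¬c (∈-lookup (# 8)) Δ[k[k+1]]≡¬c refl
    ...     | inj₁ Δ[k[k+1]]≡c with same-or-opposite (Δ (k + 2)) c
    ...       | inj₁ Δ[k+2]≡c = ones+twos≡k+2 c (≤-trans (m≤m+n 2 2) 4≤k) Δ1≡c Δ2≡c Δ[k+2]≡c
    ...       | inj₂ Δ[k+2]≡¬c with same-or-opposite (Δ (k * (k + 2))) c
    ...         | inj₂ Δ[k[k+2]]≡¬c =
                  replicate-solution (∈-lookup (# 4)) Δ[k+2]≡¬c (∈-lookup (# 9)) Δ[k[k+2]]≡¬c refl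
    ...         | inj₁ Δ[k[k+2]]≡c =
                  ones+twos+k[k+1]≡k[k+2] c (≤-trans (m≤m+n 2 2) 4≤k) Δ1≡c Δ2≡c
                    Δ[k[k+1]]≡c Δ[k[k+2]]≡c

lemma3p2 : (k m : ℕ) → k ≡ 2 * m → 4 ≤ k → (Δ : ℕ → Bool) → MonoSolution k (setA k) Δ
lemma3p2 k m k≡2m 4≤k Δ with same-or-opposite (Δ 3) (Δ 2) | same-or-opposite (Δ (2 * k)) (Δ 2)
... | inj₁ Δ3≡Δ2  | _ = three-like-two Δ 4≤k (Δ 2) refl Δ3≡Δ2
... | inj₂ _      | inj₁ Δ2k≡Δ2 =
      replicate-solution (∈-lookup (# 1)) refl (∈-lookup (# 5)) Δ2k≡Δ2 (*-comm k 2)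
... | inj₂ Δ3≡¬Δ2 | inj₂ Δ2k≡¬Δ2 = three-unlike-two Δ 4≤k m (Δ 2) k≡2m refl Δ3≡¬Δ2 Δ2k≡¬Δ2
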